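{- For every positive integer $e$ and every positive divisor $d$ of $e$, the path $P_{e+1}$ on $e+1$ vertices admits a $d$-graceful $\alpha$-labeling.
   Context: For a graph $\Gamma$ of size $e$ and a divisor $d$ of $e$ with $e=d\cdot m$, a $d$-graceful labeling of $\Gamma$ is an injective function $f:V(\Gamma)\to\{0,1,\ldots,d(m+1)-1\}$ such that $\{|f(x)-f(y)| : [x,y]\in E(\Gamma)\}=\{1,2,\ldots,d(m+1)-1\}\setminus\{m+1,2(m+1),\ldots,(d-1)(m+1)\}$. If $\Gamma$ is bipartite with parts $X,Y$, a $d$-graceful $\alpha$-labeling is a $d$-graceful labeling $f$ such that $\max f(X)<\min f(Y)$ for a suitable ordering of the two parts. The path $P_{e+1}$ has $e+1$ vertices and $e$ edges. -}

module Defs where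

open import Data.Nat using (ℕ; suc; _+_; _*_; _<_; _≤_; ∣_-_∣)
open import Data.Nat.Divisibility using (_∣_)
open import Data.Fin using (Fin; toℕ; inject₁) renaming (suc to fsuc)
open import Data.Product using (Σ; _×_; ∃; ∃-syntax)
open import Data.Sum using (_⊎_)
open import Function using (_⇔_)
open import Function.Definitions using (Injective)
open import Relation.Binary.PropositionalEquality using (_≡_)
open import Relation.Nullary using (¬_)

-- The path P_{e+1}: vertices Fin (suc e) = {0,…,e}; edges [i, i+1] for i : Fin e.
-- Edge i has endpoints  inject₁ i  and  fsuc i.
edgeLabel : (e : ℕ) → (Fin (suc e) → ℕ) → Fin e → ℕ
edgeLabel e f i = ∣ f (inject₁ i) - f (fsuc i) ∣

-- d-graceful labeling of P_{e+1}, where e = d * m.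
-- Labels lie in {0,…,d(m+1)-1}; the set of edge labels is
-- {1,…,d(m+1)-1} \ {m+1, 2(m+1), …, (d-1)(m+1)}.
IsDGraceful : (e d m : ℕ) → (Fin (suc e) → ℕ) → Set
IsDGraceful e d m f =
  Injective _≡_ _≡_ f
  × (∀ v → f v < d * (m + 1))
  × (∀ k → (∃[ i ] edgeLabel e f i ≡ k)
           ⇔ (1 ≤ k × k < d * (m + 1)
              × ¬ (∃[ j ] (1 ≤ j × j ≤ d ∸ 1 × k ≡ j * (m + 1)))))
  where open import Data.Nat using (_∸_)

EvenV : {n : ℕ} → Fin n → Set
EvenV v = 2 ∣ toℕ v

OddV : {n : ℕ} → Fin n → Set
OddV v = ¬ (2 ∣ toℕ v)

Below : {n : ℕ} → (Fin n → ℕ) → (Fin n → Set) → (Fin n → Set) → Set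
Below f A B = ∀ x y → A x → B y → f x < f y

IsDGracefulAlpha : (e d m : ℕ) → (Fin (suc e) → ℕ) → Set
IsDGracefulAlpha e d m f =
  IsDGraceful e d m f × (Below f EvenV OddV ⊎ Below f OddV EvenV)

module Submission where

-- Zigzag labelings: for edge labels L 0 > L 1 > … > L (e-1) > 0, label the
-- vertices 0, L 0, L 0 - L 1, L 0 - L 1 + L 2, …, going up by L v after an
-- even vertex v and down by L v after an odd one.  Edge v then carries L v,
-- the even vertices carry increasing labels, the odd ones decreasing labels,
-- and every even label is below every odd label.  So the labeling is
-- injective, bounded by L 0, and an α-labeling for the parity bipartition.
--
-- The label sequence: with N = d(m+1), L k = N - 1 - (k + ⌊k/m⌋) is strictly
-- decreasing and on [0, dm) takes exactly the values in [1, N) that are not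
-- multiples of m+1: for k = s + q·m it equals (m - s) + (d-1-q)(m+1).
--
-- The theorem is the zigzag labeling of this sequence.

open import Defs
open import Data.Nat using (ℕ; suc; _*_; _<_)
open import Data.Fin using (Fin)
open import Data.Product using (∃)
open import Relation.Binary.PropositionalEquality using (_≡_)

open import Data.Nat using (zero; _+_; _∸_; _≤_; _>_; _≤?_; z≤n; s≤s; s≤s⁻¹; ∣_-_∣; NonZero; >-nonZero)
open import Data.Nat.Properties
open import Data.Nat.DivMod
open import Data.Nat.Divisibility using (_∣_; divides; ∣m+n∣m⇒∣n; ∣1⇒≡1)
open import Data.Nat.Tactic.RingSolver using (solve-∀)
open import Data.Fin using (toℕ; fromℕ<)
open import Data.Fin.Properties using (toℕ-inject₁; toℕ-injective; toℕ<n; toℕ-fromℕ<)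
open import Data.Product using (_,_; _×_; proj₁; proj₂; ∃-syntax)
open import Data.Sum using (inj₁; inj₂)
open import Data.Empty using (⊥-elim)
open import Function using (_⇔_; mk⇔)
open import Function.Construct.Composition using (_⇔-∘_)
open import Function.Definitions using (Injective)
open import Relation.Binary.Definitions using (Transitive; tri<; tri≈; tri>)
open import Relation.Binary.PropositionalEquality
  using (_≢_; refl; sym; trans; cong; cong₂; subst; subst₂; module ≡-Reasoning)
open import Relation.Nullary using (¬_; yes; no)

-- Doubling, defined so that  double (suc t)  reduces to  suc (suc (double t)).
double : ℕ → ℕ
double zero    = zero
double (suc t) = suc (suc (double t))

data ParityView : ℕ → Set where
  even : ∀ t → ParityView (double t)
  odd  : ∀ t → ParityView (suc (double t))

parityView : ∀ v → ParityView v
parityView zero = even zero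
parityView (suc v) with parityView v
... | even t = odd t
... | odd t  = even (suc t)

double≡*2 : ∀ t → double t ≡ t * 2
double≡*2 zero    = refl
double≡*2 (suc t) = cong (λ x → suc (suc x)) (double≡*2 t)

2∣double : ∀ t → 2 ∣ double t
2∣double t = divides t (double≡*2 t)

2∤suc-double : ∀ t → ¬ 2 ∣ suc (double t)
2∤suc-double t 2∣odd with ∣1⇒≡1 (∣m+n∣m⇒∣n (subst (2 ∣_) (+-comm 1 (double t)) 2∣odd) (2∣double t))
... | ()

interleave : (ℕ → ℕ) → (ℕ → ℕ) → ℕ → ℕ
interleave a b zero          = a 0
interleave a b (suc zero)    = b 0
interleave a b (suc (suc v)) = interleave (λ t → a (suc t)) (λ t → b (suc t)) v

interleave-even : ∀ a b t → interleave a b (double t) ≡ a t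
interleave-even a b zero    = refl
interleave-even a b (suc t) = interleave-even (λ t → a (suc t)) (λ t → b (suc t)) t

interleave-odd : ∀ a b t → interleave a b (suc (double t)) ≡ b t
interleave-odd a b zero    = refl
interleave-odd a b (suc t) = interleave-odd (λ t → a (suc t)) (λ t → b (suc t)) t

module OnRange (B : ℕ → Set) (B-down : ∀ {t} → B (suc t) → B t) where

  chain : (R : ℕ → ℕ → Set) → Transitive R → (g : ℕ → ℕ) →
          (∀ t → B (suc t) → R (g t) (g (suc t))) →
          ∀ {i j} → i < j → B j → R (g i) (g j)
  chain R R-trans g step {i} {suc j} (s≤s i≤j) Bj with m≤n⇒m<n∨m≡n i≤j
  ... | inj₁ i<j  = R-trans {g i} {g j} {g (suc j)} (chain R R-trans g step i<j (B-down Bj)) (step j Bj)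
  ... | inj₂ refl = step j Bj

  injectiveOn : (g : ℕ → ℕ) → (∀ {i j} → i < j → B j → g i ≢ g j) →
                ∀ {i j} → B i → B j → g i ≡ g j → i ≡ j
  injectiveOn g apart {i} {j} Bi Bj gi≡gj with <-cmp i j
  ... | tri< i<j _ _ = ⊥-elim (apart i<j Bj gi≡gj)
  ... | tri≈ _ i≡j _ = i≡j
  ... | tri> _ _ j<i = ⊥-elim (apart j<i Bi (sym gi≡gj))

module Zigzag (L : ℕ → ℕ) (L-decr : ∀ k → 0 < L (suc k) → L (suc k) < L k)
              (e : ℕ) (L-pos : ∀ k → k < e → 0 < L k) where

  L-antitone : ∀ k → L (suc k) ≤ L k
  L-antitone k with L (suc k) | L-decr k
  ... | zero  | _    = z≤n
  ... | suc l | decr = <⇒≤ (decr (s≤s z≤n))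

  L-strict : ∀ k → suc k < e → L (suc k) < L k
  L-strict k lt = L-decr k (L-pos (suc k) lt)

  -- Labels of the even vertices 2t and of the odd vertices 2t+1.
  mutual
    ev : ℕ → ℕ
    ev zero    = 0
    ev (suc t) = od t ∸ L (suc (double t))

    od : ℕ → ℕ
    od t = ev t + L (double t)

  zig : ℕ → ℕ
  zig = interleave ev od

  -- The downward step from an odd vertex does not underflow.
  L≤od : ∀ t → L (suc (double t)) ≤ od t
  L≤od t = ≤-trans (L-antitone (double t)) (m≤n+m (L (double t)) (ev t))

  zig-edge : ∀ v → ∣ zig v - zig (suc v) ∣ ≡ L v
  zig-edge v with parityView v
  ... | even t = begin
    ∣ zig (double t) - zig (suc (double t)) ∣ ≡⟨ cong₂ ∣_-_∣ (interleave-even ev od t) (interleave-odd ev od t) ⟩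
    ∣ ev t - ev t + L (double t) ∣           ≡⟨ ∣m-m+n∣≡n (ev t) (L (double t)) ⟩
    L (double t)                              ∎
    where open ≡-Reasoning
  ... | odd t = begin
    ∣ zig (suc (double t)) - zig (double (suc t)) ∣ ≡⟨ cong₂ ∣_-_∣ (interleave-odd ev od t) (interleave-even ev od (suc t)) ⟩
    ∣ od t - od t ∸ L (suc (double t)) ∣           ≡⟨ m≤n⇒∣n-m∣≡n∸m (m∸n≤m (od t) (L (suc (double t)))) ⟩
    od t ∸ (od t ∸ L (suc (double t)))              ≡⟨ m∸[m∸n]≡n (L≤od t) ⟩
    L (suc (double t))                              ∎
    where open ≡-Reasoning

  EvenOnPath : ℕ → Set
  EvenOnPath t = double t ≤ e

  OddOnPath : ℕ → Set
  OddOnPath t = suc (double t) ≤ e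

  EvenOnPath-down : ∀ {t} → EvenOnPath (suc t) → EvenOnPath t
  EvenOnPath-down h = ≤-trans (n≤1+n _) (≤-trans (n≤1+n _) h)

  OddOnPath-down : ∀ {t} → OddOnPath (suc t) → OddOnPath t
  OddOnPath-down h = ≤-trans (n≤1+n _) (≤-trans (n≤1+n _) h)

  module Ev = OnRange EvenOnPath EvenOnPath-down
  module Od = OnRange OddOnPath OddOnPath-down

  -- One zigzag step: up by L(2t), then down by the smaller L(2t+1).
  ev-step : ∀ t → EvenOnPath (suc t) → ev t < ev (suc t)
  ev-step t lt = begin-strict
    ev t                                        <⟨ m<m+n (ev t) (m<n⇒0<n∸m {L (suc (double t))} {L (double t)} (L-strict (double t) lt)) ⟩
    ev t + (L (double t) ∸ L (suc (double t)))  ≡⟨ +-∸-assoc (ev t) (L-antitone (double t)) ⟨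
    ev (suc t)                                  ∎
    where open ≤-Reasoning

  -- Down by L(2t+1), then up by the smaller L(2t+2).
  od-step : ∀ t → OddOnPath (suc t) → od (suc t) < od t
  od-step t lt = begin-strict
    od (suc t)                                          <⟨ +-monoʳ-< (ev (suc t)) (L-strict (suc (double t)) lt) ⟩
    od t ∸ L (suc (double t)) + L (suc (double t))      ≡⟨ m∸n+n≡m (L≤od t) ⟩
    od t                                                ∎
    where open ≤-Reasoning

  ev-increasing : ∀ {i j} → i < j → EvenOnPath j → ev i < ev j
  ev-increasing = Ev.chain _<_ <-trans ev ev-step

  od-decreasing : ∀ {i j} → i < j → OddOnPath j → od i > od j
  od-decreasing = Od.chain _>_ (λ i>j j>k → <-trans j>k i>j) od od-step

  ev-monotone : ∀ {i j} → i ≤ j → EvenOnPath j → ev i ≤ ev j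
  ev-monotone i≤j Bj with m≤n⇒m<n∨m≡n i≤j
  ... | inj₁ i<j  = <⇒≤ (ev-increasing i<j Bj)
  ... | inj₂ refl = ≤-refl

  od-antitone : ∀ {i j} → i ≤ j → OddOnPath j → od j ≤ od i
  od-antitone i≤j Bj with m≤n⇒m<n∨m≡n i≤j
  ... | inj₁ i<j  = <⇒≤ (od-decreasing i<j Bj)
  ... | inj₂ refl = ≤-refl

  ev<od : ∀ i j → EvenOnPath i → OddOnPath j → ev i < od j
  ev<od i j Bi Bj with i ≤? j
  ... | yes i≤j = ≤-<-trans (ev-monotone i≤j (≤-trans (n≤1+n (double j)) Bj)) (m<m+n (ev j) (L-pos (double j) Bj))
  ev<od zero j Bi Bj | no i≰j = ⊥-elim (i≰j z≤n)
  ev<od (suc i) j Bi Bj | no i≰j = begin-strict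
    ev (suc i)                  <⟨ ∸-monoʳ-< (L-pos (suc (double i)) Bi) (L≤od i) ⟩
    od i                        ≤⟨ od-antitone (s≤s⁻¹ (≰⇒> i≰j)) (≤-trans (n≤1+n _) Bi) ⟩
    od j                        ∎
    where open ≤-Reasoning

  zig-injective : ∀ {v w} → v ≤ e → w ≤ e → zig v ≡ zig w → v ≡ w
  zig-injective {v} {w} v≤e w≤e zv≡zw with parityView v | parityView w
  ... | even i | even j = cong double (Ev.injectiveOn ev (λ i<j Bj → <⇒≢ (ev-increasing i<j Bj)) {i} {j} v≤e w≤e
          (trans (sym (interleave-even ev od i)) (trans zv≡zw (interleave-even ev od j))))
  ... | odd i  | odd j  = cong (λ t → suc (double t)) (Od.injectiveOn od (λ i<j Bj → >⇒≢ (od-decreasing i<j Bj)) {i} {j} v≤e w≤e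
          (trans (sym (interleave-odd ev od i)) (trans zv≡zw (interleave-odd ev od j))))
  ... | even i | odd j  = ⊥-elim (<⇒≢ (ev<od i j v≤e w≤e)
          (trans (sym (interleave-even ev od i)) (trans zv≡zw (interleave-odd ev od j))))
  ... | odd i  | even j = ⊥-elim (<⇒≢ (ev<od j i w≤e v≤e)
          (trans (sym (interleave-even ev od j)) (trans (sym zv≡zw) (interleave-odd ev od i))))

  -- All labels lie in [0, L 0]: od 0 = L 0 is the largest one.
  zig-bound : 0 < e → ∀ {v} → v ≤ e → zig v ≤ L 0
  zig-bound 0<e {v} v≤e with parityView v
  ... | even t = subst (_≤ L 0) (sym (interleave-even ev od t)) (<⇒≤ (ev<od t 0 v≤e 0<e))
  ... | odd t  = subst (_≤ L 0) (sym (interleave-odd ev od t)) (od-antitone z≤n v≤e)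

  zig-alpha : ∀ {v w} → v ≤ e → w ≤ e → 2 ∣ v → ¬ 2 ∣ w → zig v < zig w
  zig-alpha {v} {w} v≤e w≤e 2∣v 2∤w with parityView v | parityView w
  ... | odd i  | _      = ⊥-elim (2∤suc-double i 2∣v)
  ... | even i | even j = ⊥-elim (2∤w (2∣double j))
  ... | even i | odd j  = subst₂ _<_ (sym (interleave-even ev od i)) (sym (interleave-odd ev od j))
                                 (ev<od i j v≤e w≤e)

  label : Fin (suc e) → ℕ
  label x = zig (toℕ x)

  onPath : (x : Fin (suc e)) → toℕ x ≤ e
  onPath x = s≤s⁻¹ (toℕ<n x)

  label-injective : Injective _≡_ _≡_ label
  label-injective {x} {y} eq = toℕ-injective (zig-injective (onPath x) (onPath y) eq)

  label-bound : 0 < e → ∀ x → label x ≤ L 0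
  label-bound 0<e x = zig-bound 0<e (onPath x)

  label-edge : ∀ i → edgeLabel e label i ≡ L (toℕ i)
  label-edge i = trans (cong (λ v → ∣ zig v - zig (suc (toℕ i)) ∣) (toℕ-inject₁ i)) (zig-edge (toℕ i))

  edge-labels : ∀ k → (∃[ i ] edgeLabel e label i ≡ k) ⇔ (∃[ j ] j < e × L j ≡ k)
  edge-labels k = mk⇔
    (λ { (i , refl) → toℕ i , toℕ<n i , sym (label-edge i) })
    (λ { (j , j<e , refl) → fromℕ< j<e , trans (label-edge (fromℕ< j<e)) (cong L (toℕ-fromℕ< j<e)) })

  label-alpha : Below label EvenV OddV
  label-alpha x y = zig-alpha (onPath x) (onPath y)

-- Complementary positions:  n ≡ a + suc b  says that a and b are mirror
-- images in [0, n), i.e. a + b = n - 1.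

complement : ∀ {a n} → a < n → ∃[ b ] n ≡ a + suc b
complement {a} a<n with m≤n⇒∃[o]m+o≡n a<n
... | b , 1+a+b≡n = b , trans (sym 1+a+b≡n) (sym (+-suc a b))

complement-sym : ∀ {a b n} → n ≡ a + suc b → n ≡ b + suc a
complement-sym {a} {b} n≡ = trans n≡ (trans (+-suc a b) (trans (cong suc (+-comm a b)) (sym (+-suc b a))))

complement-< : ∀ {a b n} → n ≡ a + suc b → b < n
complement-< {a} {b} n≡ = subst (b <_) (sym n≡) (m≤n+m (suc b) a)

split-total : ∀ {d m q t s u} → d ≡ q + suc t → m ≡ s + suc u →
              d * (m + 1) ≡ (suc u + t * (m + 1)) + suc (s + q * m + q)
split-total {q = q} {t} {s} {u} refl refl = identity q t s u
  where
    identity : ∀ q t s u → (q + suc t) * (s + suc u + 1)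
                           ≡ (suc u + t * (s + suc u + 1)) + suc (s + q * (s + suc u) + q)
    identity = solve-∀

-- The edge-label sequence for parameters d and m.  An edge index k < dm is
-- viewed as the position  k = s + q·m  with  q < d  and  s < m.

module Labels (d m : ℕ) .{{_ : NonZero m}} where

  private instance
    m+1-nonZero : NonZero (m + 1)
    m+1-nonZero = >-nonZero (m≤n+m 1 m)

  Allowed : ℕ → Set
  Allowed k = 1 ≤ k × k < d * (m + 1) × ¬ (∃[ j ] (1 ≤ j × j ≤ d ∸ 1 × k ≡ j * (m + 1)))

  form⇒allowed : ∀ {t u} → t < d → u < m → Allowed (suc u + t * (m + 1))
  form⇒allowed {t} {u} t<d u<m = s≤s z≤n , below-total , not-multiple
    where
      1+u<m+1 : suc u < m + 1
      1+u<m+1 = <-≤-trans (s≤s u<m) (≤-reflexive (+-comm 1 m))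
      below-total : suc u + t * (m + 1) < d * (m + 1)
      below-total = <-≤-trans (+-monoˡ-< (t * (m + 1)) 1+u<m+1) (*-monoˡ-≤ (m + 1) t<d)
      not-multiple : ¬ (∃[ j ] (1 ≤ j × j ≤ d ∸ 1 × suc u + t * (m + 1) ≡ j * (m + 1)))
      not-multiple (j , _ , _ , eq) with
        trans (sym (m<n⇒m%n≡m 1+u<m+1))
          (trans (sym ([m+kn]%n≡m%n (suc u) t (m + 1)))
            (trans (cong (_% (m + 1)) eq) (m*n%n≡0 j (m + 1))))
      ... | ()

  allowed⇒form : ∀ {k} → Allowed k → ∃[ t ] ∃[ u ] (t < d × u < m × k ≡ suc u + t * (m + 1))
  allowed⇒form {k} (1≤k , k<N , not-multiple) =
    byDivision (k % (m + 1)) (k / (m + 1)) (m≡m%n+[m/n]*n k (m + 1)) (m%n<n k (m + 1)) (m<n*o⇒m/o<n k<N)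
    where
      byDivision : ∀ r j → k ≡ r + j * (m + 1) → r < m + 1 → j < d →
                   ∃[ t ] ∃[ u ] (t < d × u < m × k ≡ suc u + t * (m + 1))
      byDivision zero zero k≡0 _ _ with subst (1 ≤_) k≡0 1≤k
      ... | ()
      byDivision zero (suc j) k≡ _ j<d = ⊥-elim (not-multiple (suc j , s≤s z≤n , ∸-monoˡ-≤ 1 j<d , k≡))
      byDivision (suc u) j k≡ r<m+1 j<d = j , u , j<d , s≤s⁻¹ (subst (suc (suc u) ≤_) (+-comm m 1) r<m+1) , k≡

  L : ℕ → ℕ
  L k = d * (m + 1) ∸ suc (k + k / m)

  -- k + ⌊k/m⌋ strictly increases, so L decreases while it is positive.
  L-decr : ∀ k → 0 < L (suc k) → L (suc k) < L k
  L-decr k pos = ∸-monoʳ-< {d * (m + 1)} (s≤s (s≤s (+-monoʳ-≤ k (/-monoˡ-≤ m (n≤1+n k)))))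
                           (<⇒≤ (m∸n≢0⇒n<m (m<n⇒n≢0 pos)))

  div-position : ∀ q {s} → s < m → (s + q * m) / m ≡ q
  div-position q {s} s<m = begin
    (s + q * m) / m      ≡⟨ +-distrib-/ s (q * m) remainders<m ⟩
    s / m + q * m / m    ≡⟨ cong₂ _+_ (m<n⇒m/n≡0 s<m) (m*n/n≡m q m) ⟩
    q                    ∎
    where
      open ≡-Reasoning
      remainders<m : s % m + q * m % m < m
      remainders<m = subst (_< m)
        (sym (trans (cong₂ _+_ (m<n⇒m%n≡m s<m) (m*n%n≡0 q m)) (+-identityʳ s))) s<m

  -- L sends position (q, s) to the mirrored position (t, u).
  L-at : ∀ {q t s u} → d ≡ q + suc t → m ≡ s + suc u → L (s + q * m) ≡ suc u + t * (m + 1)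
  L-at {q} {t} {s} {u} d≡ m≡ = begin
    d * (m + 1) ∸ suc (s + q * m + (s + q * m) / m)
      ≡⟨ cong (λ x → d * (m + 1) ∸ suc (s + q * m + x)) (div-position q (complement-< (complement-sym m≡))) ⟩
    d * (m + 1) ∸ suc (s + q * m + q)
      ≡⟨ cong (_∸ suc (s + q * m + q)) (split-total d≡ m≡) ⟩
    (suc u + t * (m + 1)) + suc (s + q * m + q) ∸ suc (s + q * m + q)
      ≡⟨ m+n∸n≡m (suc u + t * (m + 1)) (suc (s + q * m + q)) ⟩
    suc u + t * (m + 1)  ∎
    where open ≡-Reasoning

  position-bound : ∀ {q s} → q < d → s < m → s + q * m < d * m
  position-bound {q} q<d s<m = <-≤-trans (+-monoˡ-< (q * m) s<m) (*-monoˡ-≤ m q<d)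

  L-allowed : ∀ k → k < d * m → Allowed (L k)
  L-allowed k k<dm with complement (m<n*o⇒m/o<n k<dm) | complement (m%n<n k m)
  ... | t , d≡ | u , m≡ = subst Allowed (sym L-k) (form⇒allowed (complement-< d≡) (complement-< m≡))
    where
      L-k : L k ≡ suc u + t * (m + 1)
      L-k = trans (cong L (m≡m%n+[m/n]*n k m)) (L-at d≡ m≡)

  L-onto : ∀ {k} → Allowed k → ∃[ i ] (i < d * m × L i ≡ k)
  L-onto a with allowed⇒form a
  ... | t , u , t<d , u<m , refl with complement t<d | complement u<m
  ... | q , d≡ | s , m≡ =
    s + q * m , position-bound (complement-< d≡) (complement-< m≡) , L-at (complement-sym d≡) (complement-sym m≡)

  L-positive : ∀ k → k < d * m → 0 < L k
  L-positive k k<dm = proj₁ (L-allowed k k<dm)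

  L-image : ∀ k → (∃[ j ] (j < d * m × L j ≡ k)) ⇔ Allowed k
  L-image k = mk⇔ (λ { (j , j<dm , refl) → L-allowed j j<dm }) L-onto

-- For m = 0 the hypothesis e > 0 fails; otherwise take the zigzag labeling
-- of the sequence L, whose labels stay below L 0 < d(m+1).
theorem3p1 : (e d m : ℕ) → 0 < e → e ≡ d * m →
    ∃ λ (f : Fin (suc e) → ℕ) → IsDGracefulAlpha e d m f
theorem3p1 e d zero 0<e e≡d*0 = ⊥-elim (<⇒≢ 0<e (sym (trans e≡d*0 (*-zeroʳ d))))
theorem3p1 .(d * suc n) d (suc n) 0<e refl =
  label , (label-injective , labels-below , λ k → L-image k ⇔-∘ edge-labels k) , inj₁ label-alpha
  where
    open Labels d (suc n)
    open Zigzag L L-decr (d * suc n) L-positive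

    labels-below : ∀ x → label x < d * (suc n + 1)
    labels-below x = ≤-<-trans (label-bound 0<e x) (proj₁ (proj₂ (L-allowed 0 0<e)))
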